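{- Let $N\ge0$ and $\mathcal C=\{V\}\cup\{S_k:k\le N\}=\{V,U_N,\ldots,U_0,D_1,D_2,\ldots\}$. For $m\ge0$ and $n\ge1$, $$|\mathcal F_{\mathcal C}(m,n)|=\binom{(N+2)n+m}{2n},\qquad |\mathcal P_{\mathcal C}(1,n)|=\frac1n\binom{(N+2)n}{2n-1}.$$
   Context: Steps: $V=(0,-1)$ and $S_k=(1,k)$ for $k\in\mathbb Z$; $U_k=S_k$ for $k\ge0$, $D_j=S_{ -j}$ for $j\ge1$. For a set of steps $\mathcal S$, an $\mathcal S$-path is a finite sequence of steps from $\mathcal S$ starting at $(0,0)$. $\mathcal F_{\mathcal S}(m,n)$ is the set of $\mathcal S$-paths ending at $(n,-m)$; $\mathcal P_{\mathcal S}(m,n)$ is the subset of those all of whose points except possibly the last lie on or above the $x$-axis. -}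

module Defs where

open import Data.Nat using (ℕ; zero; suc)
open import Data.Integer using (ℤ; +_; -_; _+_; _-_; _≤_)
open import Data.List using (List; []; _∷_)
open import Data.List.Relation.Unary.All using (All)
open import Data.Product using (Σ; _×_)
open import Relation.Binary.PropositionalEquality using (_≡_)

data Step (N : ℕ) : Set where
  V : Step N
  S : (k : ℤ) → k ≤ + N → Step N

dx : {N : ℕ} → Step N → ℕ
dx V       = 0
dx (S _ _) = 1

dy : {N : ℕ} → Step N → ℤ
dy V       = - (+ 1)
dy (S k _) = k

Path : ℕ → Set
Path N = List (Step N)

xEnd : {N : ℕ} → Path N → ℕ
xEnd []      = 0
xEnd (s ∷ p) = dx s Data.Nat.+ xEnd p

yEnd : {N : ℕ} → Path N → ℤ
yEnd []      = + 0
yEnd (s ∷ p) = dy s + yEnd p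

heightsButLast : {N : ℕ} → ℤ → Path N → List ℤ
heightsButLast y []      = []
heightsButLast y (s ∷ p) = y ∷ heightsButLast (y + dy s) p

F : (N m n : ℕ) → Set
F N m n = Σ (Path N) λ p → (xEnd p ≡ n) × (yEnd p ≡ - (+ m))

P : (N m n : ℕ) → Set
P N m n = Σ (Path N) λ p →
  ((xEnd p ≡ n) × (yEnd p ≡ - (+ m))) × All (λ y → + 0 ≤ y) (heightsButLast (+ 0) p)

-- Give the vertical step weight 1 and the step S_k weight N − k ≥ 0. Along any path
-- y + weight = N·x, so F(m,n) consists of the paths with n slanted steps and weight Nn + m.
-- Such a path is determined by the lengths of its n + 1 maximal vertical runs interleaved with
-- the weights of its n slanted steps: 2n + 1 natural numbers adding up to Nn + m, which stars
-- and bars counts as C(Nn + m + 2n, 2n).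
--
-- For P(1,n) we use the cycle lemma. Among the rotations of a path ending at height −1, exactly
-- one stays on or above the axis before its last point: the one starting right after the first
-- point of minimal height. So marking one of the n slanted steps of a path of P(1,n) and
-- rotating the path to start at the mark produces every path of F(1,n) that starts with a
-- slanted step exactly once. Coded as above, these are the 2n-part compositions of Nn + 1, so
-- n·|P(1,n)| = C((N + 2)n, 2n − 1).
module Submission where

open import Defs
open import Axiom.UniquenessOfIdentityProofs.WithK using (uip)
open import Data.Empty using (⊥-elim)
open import Data.Fin using (Fin; zero; suc)
open import Data.Fin.Permutation using (↔⇒≡)
open import Data.Fin.Properties using (+↔⊎; *↔×)
open import Data.Integer as ℤ using (ℤ; +_; -_)
import Data.Integer.Properties as ℤP
open import Data.Integer.Tactic.RingSolver using (solve-∀)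
open import Data.List using (List; []; _∷_; _++_; map)
import Data.List.Properties as List
open import Data.List.Relation.Unary.All as All using (All; []; _∷_)
import Data.List.Relation.Unary.All.Properties as All
open import Data.Nat using (ℕ; zero; suc; _+_; _*_; _∸_; _≤_)
open import Data.Nat.Combinatorics using (_C_; nCn≡1; nCk+nC[k+1]≡[n+1]C[k+1])
import Data.Nat.Properties as ℕP
import Data.Nat.Tactic.RingSolver as ℕ-Solver
open import Data.Product using (Σ; _×_; _,_; proj₁; proj₂)
open import Data.Product.Function.Dependent.Propositional using (Σ-↔)
open import Data.Product.Function.NonDependent.Propositional using (_×-↔_)
open import Data.Sum using (_⊎_; inj₁; inj₂)
open import Data.Sum.Function.Propositional using (_⊎-↔_)
open import Data.Vec using (Vec; []; _∷_; sum)
open import Function using (_∘_)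
open import Function.Bundles using (_↔_; _⇔_; mk↔ₛ′; mk⇔; Inverse; Equivalence)
open import Function.Properties.Inverse using (↔-refl; ↔-sym; ↔-trans)
open import Function.Related.TypeIsomorphisms using (Σ-assoc; ×-comm)
open import Relation.Binary.PropositionalEquality using (_≡_; refl; sym; trans; cong; subst)
import Relation.Binary.PropositionalEquality as ≡
open import Relation.Nullary using (¬_; Irrelevant; Dec; yes; no)
open import Relation.Unary using (Decidable)

open Inverse using (to; strictlyInverseˡ; strictlyInverseʳ)

infixr 2 _⟫_
_⟫_ : {A B C : Set} → A ↔ B → B ↔ C → A ↔ C
_⟫_ = ↔-trans

Fin-cong : {m n : ℕ} → m ≡ n → Fin m ↔ Fin n
Fin-cong refl = ↔-refl

Σ-≡-irrelevant : {A : Set} {B : A → Set} → (∀ a → Irrelevant (B a)) →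
                 {u v : Σ A B} → proj₁ u ≡ proj₁ v → u ≡ v
Σ-≡-irrelevant irr {a , b} {.a , b′} refl = cong (a ,_) (irr a b b′)

≡×≡-irrelevant : {A B : Set} {a a′ : A} {b b′ : B} → Irrelevant (a ≡ a′ × b ≡ b′)
≡×≡-irrelevant (e₁ , e₂) (e₁′ , e₂′) = ≡.cong₂ _,_ (uip e₁ e₁′) (uip e₂ e₂′)

prop-↔ : {A B : Set} → Irrelevant A → Irrelevant B → A ⇔ B → A ↔ B
prop-↔ irrA irrB A⇔B =
  mk↔ₛ′ (Equivalence.to A⇔B) (Equivalence.from A⇔B) (λ _ → irrB _ _) (λ _ → irrA _ _)

Σ-fiber-↔ : {A B C : Set} (e : A ↔ B) (f : A → C) (g : B → C) → (∀ a → g (to e a) ≡ f a) →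
            ∀ c → Σ A (λ a → f a ≡ c) ↔ Σ B (λ b → g b ≡ c)
Σ-fiber-↔ e f g g∘e≡f c =
  Σ-↔ e (λ {a} → subst (λ z → (f a ≡ c) ↔ (z ≡ c)) (sym (g∘e≡f a)) ↔-refl)

decidable-prop-finite : {A : Set} → Irrelevant A → Dec A → Σ ℕ λ b → Fin b ↔ A
decidable-prop-finite irr (yes a) = 1 , mk↔ₛ′ (λ _ → a) (λ _ → zero) (irr a) (λ { zero → refl })
decidable-prop-finite irr (no ¬a) = 0 , mk↔ₛ′ (λ ()) (⊥-elim ∘ ¬a) (⊥-elim ∘ ¬a) (λ ())

Σ-Fin-suc : {M : ℕ} {Q : Fin (suc M) → Set} → Σ (Fin (suc M)) Q ↔ (Q zero ⊎ Σ (Fin M) (Q ∘ suc))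
Σ-Fin-suc = mk↔ₛ′ split join split-join join-split
  where
  split : Σ _ _ → _ ⊎ _
  split (zero  , q) = inj₁ q
  split (suc i , q) = inj₂ (i , q)
  join : _ ⊎ _ → Σ _ _
  join (inj₁ q)       = zero , q
  join (inj₂ (i , q)) = suc i , q
  split-join : ∀ x → split (join x) ≡ x
  split-join (inj₁ q)       = refl
  split-join (inj₂ (i , q)) = refl
  join-split : ∀ x → join (split x) ≡ x
  join-split (zero  , q) = refl
  join-split (suc i , q) = refl

Fin-subset-finite : {M : ℕ} (Q : Fin M → Set) → Decidable Q → (∀ i → Irrelevant (Q i)) →
                    Σ ℕ λ c → Fin c ↔ Σ (Fin M) Q
Fin-subset-finite {zero} Q dec irr = 0 , mk↔ₛ′ (λ ()) (λ ()) (λ ()) (λ ())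
Fin-subset-finite {suc M} Q dec irr
  with decidable-prop-finite (irr zero) (dec zero) | Fin-subset-finite (Q ∘ suc) (dec ∘ suc) (irr ∘ suc)
... | b , Fin-b↔Q₀ | c , Fin-c↔Qₛ =
  b + c , (+↔⊎ ⟫ (Fin-b↔Q₀ ⊎-↔ Fin-c↔Qₛ) ⟫ ↔-sym Σ-Fin-suc)

subset-finite : {A : Set} {M : ℕ} → Fin M ↔ A →
                (Q : A → Set) → Decidable Q → (∀ a → Irrelevant (Q a)) → Σ ℕ λ c → Fin c ↔ Σ A Q
subset-finite e Q dec irr with Fin-subset-finite (Q ∘ to e) (dec ∘ to e) (irr ∘ to e)
... | c , Fin-c↔Σ = c , (Fin-c↔Σ ⟫ Σ-↔ e ↔-refl)

++-≡-++ : {A : Set} (x y x′ y′ : List A) → x ++ y ≡ x′ ++ y′ →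
          (Σ (List A) λ w → x′ ≡ x ++ w × y ≡ w ++ y′) ⊎
          (Σ (List A) λ w → x ≡ x′ ++ w × y′ ≡ w ++ y)
++-≡-++ []      y x′        y′ eq = inj₁ (x′ , refl , eq)
++-≡-++ (a ∷ x) y []        y′ eq = inj₂ (a ∷ x , refl , sym eq)
++-≡-++ (a ∷ x) y (a′ ∷ x′) y′ eq with List.∷-injective eq
... | refl , eq′ with ++-≡-++ x y x′ y′ eq′
...   | inj₁ (w , refl , e) = inj₁ (w , refl , e)
...   | inj₂ (w , refl , e) = inj₂ (w , refl , e)

a-[a-b]≡b : ∀ a b → a ℤ.- (a ℤ.- b) ≡ b
a-[a-b]≡b = solve-∀

c+i≤c+j⇔i≤j : ∀ c {i j} → (c ℤ.+ i ℤ.≤ c ℤ.+ j) ⇔ (i ℤ.≤ j)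
c+i≤c+j⇔i≤j c {i} {j} = mk⇔ cancel (ℤP.+-monoʳ-≤ c)
  where
  -c+[c+i]≡i : ∀ c i → - c ℤ.+ (c ℤ.+ i) ≡ i
  -c+[c+i]≡i = solve-∀
  cancel : c ℤ.+ i ℤ.≤ c ℤ.+ j → i ℤ.≤ j
  cancel c+i≤c+j = ≡.subst₂ ℤ._≤_ (-c+[c+i]≡i c i) (-c+[c+i]≡i c j) (ℤP.+-monoʳ-≤ (- c) c+i≤c+j)

c≤c+i⇔0≤i : ∀ c {i} → (c ℤ.≤ c ℤ.+ i) ⇔ (+ 0 ℤ.≤ i)
c≤c+i⇔0≤i c =
  subst (λ z → (z ℤ.≤ c ℤ.+ _) ⇔ (+ 0 ℤ.≤ _)) (ℤP.+-identityʳ c) (c+i≤c+j⇔i≤j c)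

0≤a+z⇔m<z : ∀ a {m z} → a ℤ.+ m ≡ ℤ.-1ℤ → (+ 0 ℤ.≤ a ℤ.+ z) ⇔ (m ℤ.< z)
0≤a+z⇔m<z a {m} {z} a+m≡-1 = mk⇔
  (ℤP.suc[i]≤j⇒i<j ∘ Equivalence.to (c+i≤c+j⇔i≤j a) ∘ subst (ℤ._≤ a ℤ.+ z) (sym a+[1+m]≡0))
  (subst (ℤ._≤ a ℤ.+ z) a+[1+m]≡0 ∘ Equivalence.from (c+i≤c+j⇔i≤j a) ∘ ℤP.i<j⇒suc[i]≤j)
  where
  a+[1+m]≡1+[a+m] : ∀ a m → a ℤ.+ (+ 1 ℤ.+ m) ≡ + 1 ℤ.+ (a ℤ.+ m)
  a+[1+m]≡1+[a+m] = solve-∀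
  a+[1+m]≡0 : a ℤ.+ ℤ.suc m ≡ + 0
  a+[1+m]≡0 = trans (a+[1+m]≡1+[a+m] a m) (cong ℤ.suc a+m≡-1)

-- Stars and bars

Composition : ℕ → ℕ → Set
Composition r W = Σ (Vec ℕ r) λ v → sum v ≡ W

composition-zero : {r : ℕ} → Composition (suc r) 0 ↔ Composition r 0
composition-zero = mk↔ₛ′ drop-zero add-zero (λ _ → refl) add-drop
  where
  drop-zero : Composition (suc _) 0 → Composition _ 0
  drop-zero (zero ∷ v , e) = v , e
  add-zero : Composition _ 0 → Composition (suc _) 0
  add-zero (v , e) = 0 ∷ v , e
  add-drop : ∀ c → add-zero (drop-zero c) ≡ c
  add-drop (zero ∷ v , e) = refl

composition-suc : {r W : ℕ} → Composition (suc r) (suc W) ↔ (Composition r (suc W) ⊎ Composition (suc r) W)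
composition-suc = mk↔ₛ′ split join split-join join-split
  where
  split : Composition (suc _) (suc _) → Composition _ (suc _) ⊎ Composition (suc _) _
  split (zero  ∷ v , e) = inj₁ (v , e)
  split (suc a ∷ v , e) = inj₂ (a ∷ v , ℕP.suc-injective e)
  join : Composition _ (suc _) ⊎ Composition (suc _) _ → Composition (suc _) (suc _)
  join (inj₁ (v , e))     = 0 ∷ v , e
  join (inj₂ (a ∷ v , e)) = suc a ∷ v , cong suc e
  split-join : ∀ c → split (join c) ≡ c
  split-join (inj₁ (v , e))        = refl
  split-join (inj₂ (a ∷ v , refl)) = refl
  join-split : ∀ c → join (split c) ≡ c
  join-split (zero  ∷ v , e)    = refl
  join-split (suc a ∷ v , refl) = refl

composition↔binomial : ∀ r W → Composition (suc r) W ↔ Fin ((W + r) C r)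
composition↔binomial zero W =
  mk↔ₛ′ (λ _ → zero) (λ _ → W ∷ [] , ℕP.+-identityʳ W) (λ { zero → refl }) unique
  where
  unique : ∀ c → (W ∷ [] , ℕP.+-identityʳ W) ≡ c
  unique (a ∷ [] , e) =
    Σ-≡-irrelevant (λ _ → ℕP.≡-irrelevant) (cong (_∷ []) (trans (sym e) (ℕP.+-identityʳ a)))
composition↔binomial (suc r) zero =
  composition-zero ⟫ composition↔binomial r 0 ⟫ Fin-cong (trans (nCn≡1 r) (sym (nCn≡1 (suc r))))
composition↔binomial (suc r) (suc W) =
  composition-suc ⟫ (composition↔binomial r (suc W) ⊎-↔ composition↔binomial (suc r) W)
  ⟫ ↔-sym +↔⊎ ⟫ Fin-cong pascal
  where
  pascal : (suc W + r) C r + (W + suc r) C suc r ≡ (suc W + suc r) C suc r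
  pascal rewrite ℕP.+-suc W r = nCk+nC[k+1]≡[n+1]C[k+1] (suc (W + r)) r

module _ {N : ℕ} where

  -- Weights and the coding of paths

  depth : ℤ → ℕ
  depth k = ℤ.∣ + N ℤ.- k ∣

  stepWeight : Step N → ℕ
  stepWeight V       = 1
  stepWeight (S k _) = depth k

  weight : Path N → ℕ
  weight []      = 0
  weight (s ∷ p) = stepWeight s + weight p

  slope : ℕ → Step N
  slope j = S (+ N ℤ.- + j) (ℤP.i-j≤i (+ N) (+ j))

  stepWeight-slope : ∀ j → stepWeight (slope j) ≡ j
  stepWeight-slope j = cong ℤ.∣_∣ (a-[a-b]≡b (+ N) (+ j))

  +depth≡N-k : ∀ {k} → k ℤ.≤ + N → + depth k ≡ + N ℤ.- k
  +depth≡N-k k≤N = ℤP.0≤i⇒+∣i∣≡i (ℤP.i≤j⇒0≤j-i k≤N)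

  slope-depth : ∀ k (k≤N : k ℤ.≤ + N) → slope (depth k) ≡ S k k≤N
  slope-depth k k≤N = S-cong (trans (cong (λ z → + N ℤ.- z) (+depth≡N-k k≤N)) (a-[a-b]≡b (+ N) k))
    where
    S-cong : ∀ {k k′} {p : k ℤ.≤ + N} {q : k′ ℤ.≤ + N} → k ≡ k′ → S k p ≡ S k′ q
    S-cong {p = p} {q} refl = cong (S _) (ℤP.≤-irrelevant p q)

  dy+stepWeight : ∀ s → dy s ℤ.+ + stepWeight s ≡ + (N * dx s)
  dy+stepWeight V = cong +_ (sym (ℕP.*-zeroʳ N))
  dy+stepWeight (S k k≤N) = begin
    k ℤ.+ + depth k     ≡⟨ cong (λ z → k ℤ.+ z) (+depth≡N-k k≤N) ⟩
    k ℤ.+ (+ N ℤ.- k)   ≡⟨ b+[a-b]≡a (+ N) k ⟩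
    + N                 ≡⟨ cong +_ (sym (ℕP.*-identityʳ N)) ⟩
    + (N * 1)           ∎
    where
    open ≡.≡-Reasoning
    b+[a-b]≡a : ∀ a b → b ℤ.+ (a ℤ.- b) ≡ a
    b+[a-b]≡a = solve-∀

  yEnd+weight≡N*xEnd : ∀ p → yEnd p ℤ.+ + weight p ≡ + (N * xEnd p)
  yEnd+weight≡N*xEnd []      = cong +_ (sym (ℕP.*-zeroʳ N))
  yEnd+weight≡N*xEnd (s ∷ p) = begin
    (dy s ℤ.+ yEnd p) ℤ.+ + (stepWeight s + weight p)
      ≡⟨ cong (λ z → (dy s ℤ.+ yEnd p) ℤ.+ z) (ℤP.pos-+ (stepWeight s) (weight p)) ⟩
    (dy s ℤ.+ yEnd p) ℤ.+ (+ stepWeight s ℤ.+ + weight p)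
      ≡⟨ interchange (dy s) (yEnd p) (+ stepWeight s) (+ weight p) ⟩
    (dy s ℤ.+ + stepWeight s) ℤ.+ (yEnd p ℤ.+ + weight p)
      ≡⟨ ≡.cong₂ ℤ._+_ (dy+stepWeight s) (yEnd+weight≡N*xEnd p) ⟩
    + (N * dx s) ℤ.+ + (N * xEnd p)
      ≡⟨ sym (ℤP.pos-+ (N * dx s) (N * xEnd p)) ⟩
    + (N * dx s + N * xEnd p)
      ≡⟨ cong +_ (sym (ℕP.*-distribˡ-+ N (dx s) (xEnd p))) ⟩
    + (N * (dx s + xEnd p)) ∎
    where
    open ≡.≡-Reasoning
    interchange : ∀ a b c d → (a ℤ.+ b) ℤ.+ (c ℤ.+ d) ≡ (a ℤ.+ c) ℤ.+ (b ℤ.+ d)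
    interchange = solve-∀

  yEnd≡-m⇔weight≡N*xEnd+m : ∀ p m → (yEnd p ≡ - + m) ⇔ (weight p ≡ N * xEnd p + m)
  yEnd≡-m⇔weight≡N*xEnd+m p m = mk⇔ from-height to-height
    where
    open ≡.≡-Reasoning
    from-height : yEnd p ≡ - + m → weight p ≡ N * xEnd p + m
    from-height y≡-m = ℤP.+-injective (begin
      + weight p
        ≡⟨ w≡[y+w]-y (yEnd p) (+ weight p) ⟩
      (yEnd p ℤ.+ + weight p) ℤ.- yEnd p
        ≡⟨ ≡.cong₂ ℤ._-_ (yEnd+weight≡N*xEnd p) y≡-m ⟩
      + (N * xEnd p) ℤ.- - + m
        ≡⟨ cong (λ z → + (N * xEnd p) ℤ.+ z) (ℤP.neg-involutive (+ m)) ⟩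
      + (N * xEnd p) ℤ.+ + m
        ≡⟨ sym (ℤP.pos-+ (N * xEnd p) m) ⟩
      + (N * xEnd p + m) ∎)
      where
      w≡[y+w]-y : ∀ y w → w ≡ (y ℤ.+ w) ℤ.- y
      w≡[y+w]-y = solve-∀
    to-height : weight p ≡ N * xEnd p + m → yEnd p ≡ - + m
    to-height w≡ = begin
      yEnd p
        ≡⟨ y≡[y+w]-w (yEnd p) (+ weight p) ⟩
      (yEnd p ℤ.+ + weight p) ℤ.- + weight p
        ≡⟨ ≡.cong₂ (λ a b → a ℤ.- + b) (yEnd+weight≡N*xEnd p) w≡ ⟩
      + (N * xEnd p) ℤ.- + (N * xEnd p + m)
        ≡⟨ cong (λ z → + (N * xEnd p) ℤ.- z) (ℤP.pos-+ (N * xEnd p) m) ⟩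
      + (N * xEnd p) ℤ.- (+ (N * xEnd p) ℤ.+ + m)
        ≡⟨ a-[a+b]≡-b (+ (N * xEnd p)) (+ m) ⟩
      - + m ∎
      where
      y≡[y+w]-w : ∀ y w → y ≡ (y ℤ.+ w) ℤ.- w
      y≡[y+w]-w = solve-∀
      a-[a+b]≡-b : ∀ a b → a ℤ.- (a ℤ.+ b) ≡ - b
      a-[a+b]≡-b = solve-∀

  Ends : ℕ → ℤ → Path N → Set
  Ends n y p = xEnd p ≡ n × yEnd p ≡ y

  Ends↔weight : ∀ m n p → Ends n (- + m) p ↔ (xEnd p ≡ n × weight p ≡ N * n + m)
  Ends↔weight m n p = prop-↔ ≡×≡-irrelevant ≡×≡-irrelevant (mk⇔ to-weight from-weight)
    where
    to-weight : Ends n (- + m) p → xEnd p ≡ n × weight p ≡ N * n + m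
    to-weight (refl , y≡-m) = refl , Equivalence.to (yEnd≡-m⇔weight≡N*xEnd+m p m) y≡-m
    from-weight : xEnd p ≡ n × weight p ≡ N * n + m → Ends n (- + m) p
    from-weight (refl , w≡) = refl , Equivalence.from (yEnd≡-m⇔weight≡N*xEnd+m p m) w≡

  Walk : ℕ → Set
  Walk n = Σ (Path N) λ p → xEnd p ≡ n

  infixr 5 _∷ʷ_
  _∷ʷ_ : {n : ℕ} (s : Step N) → Walk n → Walk (dx s + n)
  s ∷ʷ (p , e) = s ∷ p , cong (λ x → dx s + x) e

  suc-head : {r : ℕ} → Vec ℕ (suc r) → Vec ℕ (suc r)
  suc-head (a ∷ v) = suc a ∷ v

  -- Run lengths of V interleaved with the weights of the slanted steps. The length is indexed by
  -- n * 2 rather than 2 * n because suc n * 2 reduces to suc (suc (n * 2)).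
  code : (p : Path N) → Vec ℕ (suc (xEnd p * 2))
  code []          = 0 ∷ []
  code (V ∷ p)     = suc-head (code p)
  code (S k _ ∷ p) = 0 ∷ depth k ∷ code p

  weight≡sum-code : ∀ p → weight p ≡ sum (code p)
  weight≡sum-code []          = refl
  weight≡sum-code (V ∷ p)     = trans (cong suc (weight≡sum-code p)) (sum-suc-head (code p))
    where
    sum-suc-head : {r : ℕ} (u : Vec ℕ (suc r)) → suc (sum u) ≡ sum (suc-head u)
    sum-suc-head (a ∷ v) = refl
  weight≡sum-code (S k _ ∷ p) = cong (λ w → depth k + w) (weight≡sum-code p)

  codeWalk : {n : ℕ} → Walk n → Vec ℕ (suc (n * 2))
  codeWalk (p , refl) = code p

  decode : {n : ℕ} → ℕ → Vec ℕ (n * 2) → Walk n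
  decode (suc a) v                = V ∷ʷ decode a v
  decode {zero} zero []           = [] , refl
  decode {suc n} zero (j ∷ b ∷ v) = slope j ∷ʷ decode b v

  decodeVec : {n : ℕ} → Vec ℕ (suc (n * 2)) → Walk n
  decodeVec (a ∷ v) = decode a v

  codeWalk-V : ∀ {n} (w : Walk n) → codeWalk (V ∷ʷ w) ≡ suc-head (codeWalk w)
  codeWalk-V (p , refl) = refl

  codeWalk-slope : ∀ {n} j (w : Walk n) → codeWalk (slope j ∷ʷ w) ≡ 0 ∷ j ∷ codeWalk w
  codeWalk-slope j (p , refl) = cong (λ i → 0 ∷ i ∷ code p) (stepWeight-slope j)

  codeWalk-decode : ∀ {n} a (v : Vec ℕ (n * 2)) → codeWalk (decode a v) ≡ a ∷ v
  codeWalk-decode {n} (suc a) v =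
    trans (codeWalk-V (decode {n} a v)) (cong suc-head (codeWalk-decode {n} a v))
  codeWalk-decode {zero} zero [] = refl
  codeWalk-decode {suc n} zero (j ∷ b ∷ v) =
    trans (codeWalk-slope j (decode {n} b v)) (cong (λ u → 0 ∷ j ∷ u) (codeWalk-decode {n} b v))

  decodeVec-code : ∀ p → decodeVec {xEnd p} (code p) ≡ (p , refl)
  decodeVec-code [] = refl
  decodeVec-code (V ∷ p) = trans (decodeVec-suc-head (xEnd p) (code p)) (cong (V ∷ʷ_) (decodeVec-code p))
    where
    decodeVec-suc-head : ∀ n (u : Vec ℕ (suc (n * 2))) → decodeVec {n} (suc-head u) ≡ V ∷ʷ decodeVec u
    decodeVec-suc-head n (a ∷ v) = refl
  decodeVec-code (S k k≤N ∷ p) = begin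
    decode zero (depth k ∷ code p)               ≡⟨ decode-zero (xEnd p) (depth k) (code p) ⟩
    slope (depth k) ∷ʷ decodeVec (code p)        ≡⟨ cong (slope (depth k) ∷ʷ_) (decodeVec-code p) ⟩
    (slope (depth k) ∷ p , refl)
      ≡⟨ Σ-≡-irrelevant (λ _ → uip) (cong (_∷ p) (slope-depth k k≤N)) ⟩
    (S k k≤N ∷ p , refl)                         ∎
    where
    open ≡.≡-Reasoning
    decode-zero : ∀ n j (u : Vec ℕ (suc (n * 2))) → decode {suc n} zero (j ∷ u) ≡ slope j ∷ʷ decodeVec u
    decode-zero n j (b ∷ v) = refl

  walk↔code : {n : ℕ} → Walk n ↔ Vec ℕ (suc (n * 2))
  walk↔code {n} = mk↔ₛ′ codeWalk decodeVec
    (λ { (a ∷ v) → codeWalk-decode {n} a v }) (λ { (p , refl) → decodeVec-code p })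

  sum-codeWalk : ∀ {n} (w : Walk n) → sum (codeWalk w) ≡ weight (proj₁ w)
  sum-codeWalk (p , refl) = sym (weight≡sum-code p)

  weighted↔composition : ∀ n W →
    (Σ (Path N) λ p → xEnd p ≡ n × weight p ≡ W) ↔ Composition (suc (n * 2)) W
  weighted↔composition n W = ↔-sym Σ-assoc ⟫ Σ-fiber-↔ walk↔code (weight ∘ proj₁) sum sum-codeWalk W

  F↔binomial : ∀ m n → F N m n ↔ Fin ((N * n + m + n * 2) C (n * 2))
  F↔binomial m n = Σ-↔ ↔-refl (λ {p} → Ends↔weight m n p)
    ⟫ weighted↔composition n _ ⟫ composition↔binomial (n * 2) (N * n + m)

  -- The cycle lemma

  heightFrom : ℤ → Path N → ℤ
  heightFrom h []      = h
  heightFrom h (s ∷ p) = heightFrom (h ℤ.+ dy s) p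

  heightFrom-++ : ∀ h x y → heightFrom h (x ++ y) ≡ heightFrom (heightFrom h x) y
  heightFrom-++ h []      y = refl
  heightFrom-++ h (s ∷ x) y = heightFrom-++ (h ℤ.+ dy s) x y

  heightsButLast-++ : ∀ h (x y : Path N) →
    heightsButLast h (x ++ y) ≡ heightsButLast h x ++ heightsButLast (heightFrom h x) y
  heightsButLast-++ h []      y = refl
  heightsButLast-++ h (s ∷ x) y = cong (h ∷_) (heightsButLast-++ (h ℤ.+ dy s) x y)

  heightFrom-shift : ∀ c h p → heightFrom (c ℤ.+ h) p ≡ c ℤ.+ heightFrom h p
  heightFrom-shift c h []      = refl
  heightFrom-shift c h (s ∷ p) =
    trans (cong (λ z → heightFrom z p) (ℤP.+-assoc c h (dy s))) (heightFrom-shift c (h ℤ.+ dy s) p)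

  heightsButLast-shift : ∀ c h (p : Path N) →
    heightsButLast (c ℤ.+ h) p ≡ map (λ z → c ℤ.+ z) (heightsButLast h p)
  heightsButLast-shift c h []      = refl
  heightsButLast-shift c h (s ∷ p) = cong ((c ℤ.+ h) ∷_)
    (trans (cong (λ z → heightsButLast z p) (ℤP.+-assoc c h (dy s))) (heightsButLast-shift c (h ℤ.+ dy s) p))

  heightFrom-relative : ∀ h p → heightFrom h p ≡ h ℤ.+ heightFrom (+ 0) p
  heightFrom-relative h p =
    trans (cong (λ z → heightFrom z p) (sym (ℤP.+-identityʳ h))) (heightFrom-shift h (+ 0) p)

  All-heightsButLast-relative : ∀ {P : ℤ → Set} h p →
    All P (heightsButLast h p) ⇔ All (λ z → P (h ℤ.+ z)) (heightsButLast (+ 0) p)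
  All-heightsButLast-relative {P} h p =
    mk⇔ (All.map⁻ ∘ subst (All P) relative) (subst (All P) (sym relative) ∘ All.map⁺)
    where
    relative : heightsButLast h p ≡ map (λ z → h ℤ.+ z) (heightsButLast (+ 0) p)
    relative = trans (cong (λ z → heightsButLast z p) (sym (ℤP.+-identityʳ h))) (heightsButLast-shift h (+ 0) p)

  heightFrom-++-sum : ∀ x y → heightFrom (+ 0) (x ++ y) ≡ heightFrom (+ 0) x ℤ.+ heightFrom (+ 0) y
  heightFrom-++-sum x y = trans (heightFrom-++ (+ 0) x y) (heightFrom-relative _ y)

  yEnd≡heightFrom : ∀ p → yEnd p ≡ heightFrom (+ 0) p
  yEnd≡heightFrom []      = refl
  yEnd≡heightFrom (s ∷ p) = begin
    dy s ℤ.+ yEnd p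
      ≡⟨ cong (λ z → dy s ℤ.+ z) (yEnd≡heightFrom p) ⟩
    dy s ℤ.+ heightFrom (+ 0) p
      ≡⟨ cong (λ z → z ℤ.+ heightFrom (+ 0) p) (sym (ℤP.+-identityˡ (dy s))) ⟩
    (+ 0 ℤ.+ dy s) ℤ.+ heightFrom (+ 0) p
      ≡⟨ sym (heightFrom-relative (+ 0 ℤ.+ dy s) p) ⟩
    heightFrom (+ 0 ℤ.+ dy s) p ∎
    where open ≡.≡-Reasoning

  xEnd-++ : ∀ (x y : Path N) → xEnd (x ++ y) ≡ xEnd x + xEnd y
  xEnd-++ []      y = refl
  xEnd-++ (s ∷ x) y =
    trans (cong (λ z → dx s + z) (xEnd-++ x y)) (sym (ℕP.+-assoc (dx s) (xEnd x) (xEnd y)))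

  yEnd-++ : ∀ (x y : Path N) → yEnd (x ++ y) ≡ yEnd x ℤ.+ yEnd y
  yEnd-++ x y = trans (yEnd≡heightFrom (x ++ y))
    (trans (heightFrom-++-sum x y) (sym (≡.cong₂ ℤ._+_ (yEnd≡heightFrom x) (yEnd≡heightFrom y))))

  Ends-rotate : ∀ {n y} x y′ → Ends n y (x ++ y′) → Ends n y (y′ ++ x)
  Ends-rotate x y′ (x≡n , y≡y) =
    trans (trans (xEnd-++ y′ x) (ℕP.+-comm (xEnd y′) (xEnd x))) (trans (sym (xEnd-++ x y′)) x≡n) ,
    trans (trans (yEnd-++ y′ x) (ℤP.+-comm (yEnd y′) (yEnd x))) (trans (sym (yEnd-++ x y′)) y≡y)

  AboveAxis : Path N → Set
  AboveAxis p = All (+ 0 ℤ.≤_) (heightsButLast (+ 0) p)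

  AboveAxis? : Decidable AboveAxis
  AboveAxis? p = All.all? (λ z → + 0 ℤP.≤? z) (heightsButLast (+ 0) p)

  -- x ++ y, started at height h, is cut at its first point of minimal height.
  record MinimumCut (h : ℤ) (x y : Path N) : Set where
    constructor cut
    field
      before : All (heightFrom h x ℤ.<_) (heightsButLast h x)
      after  : All (heightFrom h x ℤ.≤_) (heightsButLast (heightFrom h x) y)
      final  : heightFrom h x ℤ.≤ heightFrom (heightFrom h x) y

  MinimumCutOf : ℤ → Path N → Set
  MinimumCutOf h q = Σ (Path N × Path N) λ (x , y) → x ++ y ≡ q × MinimumCut h x y

  minimumCut : ∀ h q → MinimumCutOf h q
  minimumCut h [] = ([] , []) , refl , cut [] [] ℤP.≤-refl
  minimumCut h (s ∷ q) with minimumCut (h ℤ.+ dy s) q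
  ... | (x , y) , refl , cut before after final with heightFrom (h ℤ.+ dy s) x ℤP.<? h
  ...   | yes m<h = (s ∷ x , y) , refl , cut (m<h ∷ before) after final
  ...   | no  m≮h = ([] , s ∷ x ++ y) , refl , cut [] (ℤP.≤-refl ∷ later) final′
    where
    h≤m : h ℤ.≤ heightFrom (h ℤ.+ dy s) x
    h≤m = ℤP.≮⇒≥ m≮h
    later : All (h ℤ.≤_) (heightsButLast (h ℤ.+ dy s) (x ++ y))
    later = subst (All (h ℤ.≤_)) (sym (heightsButLast-++ (h ℤ.+ dy s) x y))
      (All.++⁺ (All.map (ℤP.≤-trans h≤m ∘ ℤP.<⇒≤) before) (All.map (ℤP.≤-trans h≤m) after))
    final′ : h ℤ.≤ heightFrom (h ℤ.+ dy s) (x ++ y)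
    final′ = ℤP.≤-trans (ℤP.≤-trans h≤m final)
                        (ℤP.≤-reflexive (sym (heightFrom-++ (h ℤ.+ dy s) x y)))

  heightFrom-prefix : ∀ {c} h (w y : Path N) → All (c ℤ.≤_) (heightsButLast h (w ++ y)) →
                      c ℤ.≤ heightFrom h (w ++ y) → c ℤ.≤ heightFrom h w
  heightFrom-prefix {c} h w [] _ c≤end = subst (λ p → c ℤ.≤ heightFrom h p) (List.++-identityʳ w) c≤end
  heightFrom-prefix {c} h w (s ∷ y) above _
    with All.++⁻ʳ (heightsButLast h w) (subst (All (c ℤ.≤_)) (heightsButLast-++ h w (s ∷ y)) above)
  ... | c≤ ∷ _ = c≤

  minimumCut-not-followed : ∀ h x s w y → MinimumCut h x (s ∷ w ++ y) → ¬ MinimumCut h (x ++ s ∷ w) y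
  minimumCut-not-followed h x s w y (cut _ after final) (cut before′ _ _) =
    ℤP.<-irrefl refl (ℤP.<-≤-trans m′<m m≤m′)
    where
    m m′ : ℤ
    m = heightFrom h x
    m′ = heightFrom h (x ++ s ∷ w)
    m′<m : m′ ℤ.< m
    m′<m with All.++⁻ʳ (heightsButLast h x)
                (subst (All (m′ ℤ.<_)) (heightsButLast-++ h x (s ∷ w)) before′)
    ... | m′<m ∷ _ = m′<m
    m≤m′ : m ℤ.≤ m′
    m≤m′ = subst (m ℤ.≤_) (sym (heightFrom-++ h x (s ∷ w))) (heightFrom-prefix m (s ∷ w) y after final)

  minimumCut-unique : ∀ h {x y x′ y′} → x ++ y ≡ x′ ++ y′ →
                      MinimumCut h x y → MinimumCut h x′ y′ → x ≡ x′
  minimumCut-unique h {x} {y} {x′} {y′} eq c c′ with ++-≡-++ x y x′ y′ eq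
  ... | inj₁ ([]    , refl , refl) = sym (List.++-identityʳ x)
  ... | inj₁ (s ∷ w , refl , refl) = ⊥-elim (minimumCut-not-followed h x s w y′ c c′)
  ... | inj₂ ([]    , refl , refl) = List.++-identityʳ x′
  ... | inj₂ (s ∷ w , refl , refl) = ⊥-elim (minimumCut-not-followed h x′ s w y c′ c)

  minimumCut-[] : ∀ y → yEnd y ≡ ℤ.-1ℤ → ¬ MinimumCut (+ 0) [] y
  minimumCut-[] y y≡-1 (cut _ _ final) with subst (+ 0 ℤ.≤_) (trans (sym (yEnd≡heightFrom y)) y≡-1) final
  ... | ()

  nonnegative⇔above-shifted : ∀ c y →
    All (+ 0 ℤ.≤_) (heightsButLast (+ 0) y) ⇔ All (c ℤ.≤_) (heightsButLast c y)
  nonnegative⇔above-shifted c y = mk⇔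
    (Equivalence.from relative ∘ All.map (Equivalence.from (c≤c+i⇔0≤i c)))
    (All.map (Equivalence.to (c≤c+i⇔0≤i c)) ∘ Equivalence.to relative)
    where
    relative : All (c ℤ.≤_) (heightsButLast c y) ⇔ All (λ z → c ℤ.≤ c ℤ.+ z) (heightsButLast (+ 0) y)
    relative = All-heightsButLast-relative c y

  nonnegative⇔above-minimum : ∀ a x → a ℤ.+ heightFrom (+ 0) x ≡ ℤ.-1ℤ →
    All (+ 0 ℤ.≤_) (heightsButLast a x) ⇔ All (heightFrom (+ 0) x ℤ.<_) (heightsButLast (+ 0) x)
  nonnegative⇔above-minimum a x a+m≡-1 = mk⇔
    (All.map (Equivalence.to (0≤a+z⇔m<z a a+m≡-1)) ∘ Equivalence.to relative)
    (Equivalence.from relative ∘ All.map (Equivalence.from (0≤a+z⇔m<z a a+m≡-1)))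
    where
    relative : All (+ 0 ℤ.≤_) (heightsButLast a x) ⇔ All (λ z → + 0 ℤ.≤ a ℤ.+ z) (heightsButLast (+ 0) x)
    relative = All-heightsButLast-relative a x

  minimumCut⇒aboveAxis : ∀ x y → yEnd (y ++ x) ≡ ℤ.-1ℤ → MinimumCut (+ 0) x y → AboveAxis (y ++ x)
  minimumCut⇒aboveAxis x y y≡-1 (cut before after _) =
    subst (All (+ 0 ℤ.≤_)) (sym (heightsButLast-++ (+ 0) y x))
      (All.++⁺ (Equivalence.from (nonnegative⇔above-shifted _ y) after)
               (Equivalence.from (nonnegative⇔above-minimum _ x a+m≡-1) before))
    where
    a+m≡-1 : heightFrom (+ 0) y ℤ.+ heightFrom (+ 0) x ≡ ℤ.-1ℤ
    a+m≡-1 = trans (sym (heightFrom-++-sum y x)) (trans (sym (yEnd≡heightFrom (y ++ x))) y≡-1)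

  aboveAxis⇒minimumCut : ∀ s x y → yEnd (y ++ s ∷ x) ≡ ℤ.-1ℤ → AboveAxis (y ++ s ∷ x) →
                         MinimumCut (+ 0) (s ∷ x) y
  aboveAxis⇒minimumCut s x y y≡-1 above
    with All.++⁻ (heightsButLast (+ 0) y) (subst (All (+ 0 ℤ.≤_)) (heightsButLast-++ (+ 0) y (s ∷ x)) above)
  ... | above-y , above-x@(0≤a ∷ _) = cut
    (Equivalence.to (nonnegative⇔above-minimum _ (s ∷ x) a+m≡-1) above-x)
    (Equivalence.to (nonnegative⇔above-shifted _ y) above-y)
    (subst (_ ℤ.≤_) (sym (heightFrom-relative _ y)) (Equivalence.from (c≤c+i⇔0≤i _) 0≤a))
    where
    a+m≡-1 : heightFrom (+ 0) y ℤ.+ heightFrom (+ 0) (s ∷ x) ≡ ℤ.-1ℤ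
    a+m≡-1 = trans (sym (heightFrom-++-sum y (s ∷ x))) (trans (sym (yEnd≡heightFrom (y ++ s ∷ x))) y≡-1)

  data StartsWithSlope : Path N → Set where
    slope-first : ∀ {k} {k≤N : k ℤ.≤ + N} {p} → StartsWithSlope (S k k≤N ∷ p)

  StartsWithSlope-irrelevant : ∀ {p} → Irrelevant (StartsWithSlope p)
  StartsWithSlope-irrelevant slope-first slope-first = refl

  StartsWithSlope-++ : ∀ {x y} → StartsWithSlope x → StartsWithSlope (x ++ y)
  StartsWithSlope-++ slope-first = slope-first

  StartsWithSlope-prefix : ∀ {s x y} → StartsWithSlope (s ∷ x ++ y) → StartsWithSlope (s ∷ x)
  StartsWithSlope-prefix slope-first = slope-first

  StartsWithSlope-∷↔Fin-dx : ∀ s p → StartsWithSlope (s ∷ p) ↔ Fin (dx s)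
  StartsWithSlope-∷↔Fin-dx V       p = mk↔ₛ′ (λ ()) (λ ()) (λ ()) (λ ())
  StartsWithSlope-∷↔Fin-dx (S k _) p =
    mk↔ₛ′ (λ _ → zero) (λ _ → slope-first) (λ { zero → refl }) (λ { slope-first → refl })

  SlopeMark : Path N → Set
  SlopeMark p = Σ (Path N × Path N) λ (y , x) → y ++ x ≡ p × StartsWithSlope x

  slopeMark-∷ : ∀ s p → SlopeMark (s ∷ p) ↔ (StartsWithSlope (s ∷ p) ⊎ SlopeMark p)
  slopeMark-∷ s p = mk↔ₛ′ split join split-join join-split
    where
    split : SlopeMark (s ∷ p) → StartsWithSlope (s ∷ p) ⊎ SlopeMark p
    split (([]    , x) , refl , st) = inj₁ st
    split ((_ ∷ y , x) , eq   , st) = inj₂ ((y , x) , List.∷-injectiveʳ eq , st)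
    join : StartsWithSlope (s ∷ p) ⊎ SlopeMark p → SlopeMark (s ∷ p)
    join (inj₁ st)                  = ([] , s ∷ p) , refl , st
    join (inj₂ ((y , x) , eq , st)) = (s ∷ y , x) , cong (s ∷_) eq , st
    split-join : ∀ m → split (join m) ≡ m
    split-join (inj₁ st)                    = refl
    split-join (inj₂ ((y , x) , refl , st)) = refl
    join-split : ∀ m → join (split m) ≡ m
    join-split (([]    , x) , refl , st) = refl
    join-split ((_ ∷ y , x) , refl , st) = refl

  slopeMark↔Fin-xEnd : ∀ p → SlopeMark p ↔ Fin (xEnd p)
  slopeMark↔Fin-xEnd [] = mk↔ₛ′ (⊥-elim ∘ none) (λ ()) (λ ()) (⊥-elim ∘ none)
    where
    none : ¬ SlopeMark []
    none (([] , []) , refl , ())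
  slopeMark↔Fin-xEnd (s ∷ p) =
    slopeMark-∷ s p ⟫ (StartsWithSlope-∷↔Fin-dx s p ⊎-↔ slopeMark↔Fin-xEnd p) ⟫ ↔-sym +↔⊎

  Σ-slopeMark↔split : {Q : Path N → Set} →
    Σ (Σ (Path N) Q) (SlopeMark ∘ proj₁) ↔
    Σ (Path N × Path N) (λ (y , x) → Q (y ++ x) × StartsWithSlope x)
  Σ-slopeMark↔split = mk↔ₛ′
    (λ { ((_ , q) , (yx , refl , st)) → yx , q , st })
    (λ { ((y , x) , q , st) → (y ++ x , q) , ((y , x) , refl , st) })
    (λ _ → refl)
    (λ { ((_ , q) , (yx , refl , st)) → refl })

  MarkedSplit : ℕ → Set
  MarkedSplit n = Σ (Path N × Path N) λ (y , x) →
    (Ends n ℤ.-1ℤ (y ++ x) × AboveAxis (y ++ x)) × StartsWithSlope x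

  SlopeFirst : ℕ → Set
  SlopeFirst n = Σ (Path N) λ q → Ends n ℤ.-1ℤ q × StartsWithSlope q

  Ends×StartsWithSlope-irrelevant : ∀ {n} q → Irrelevant (Ends n ℤ.-1ℤ q × StartsWithSlope q)
  Ends×StartsWithSlope-irrelevant q (e , st) (e′ , st′) =
    ≡.cong₂ _,_ (≡×≡-irrelevant e e′) (StartsWithSlope-irrelevant st st′)

  MarkedSplit-irrelevant : ∀ {n} yx → Irrelevant
    ((Ends n ℤ.-1ℤ (proj₁ yx ++ proj₂ yx) × AboveAxis (proj₁ yx ++ proj₂ yx)) × StartsWithSlope (proj₂ yx))
  MarkedSplit-irrelevant _ ((e , a) , st) ((e′ , a′) , st′) = ≡.cong₂ _,_
    (≡.cong₂ _,_ (≡×≡-irrelevant e e′) (All.irrelevant ℤP.≤-irrelevant a a′)) (StartsWithSlope-irrelevant st st′)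

  rotate : ∀ {n} → MarkedSplit n → SlopeFirst n
  rotate ((y , x) , (ends , _) , st) = x ++ y , Ends-rotate y x ends , StartsWithSlope-++ st

  unrotate : ∀ {n} q → Ends n ℤ.-1ℤ q → StartsWithSlope q → MinimumCutOf (+ 0) q → MarkedSplit n
  unrotate _ (_ , y≡-1) _ (([] , y) , refl , c) = ⊥-elim (minimumCut-[] y y≡-1 c)
  unrotate {n} _ ends st ((s ∷ x , y) , refl , c) =
    (y , s ∷ x) , (ends′ , minimumCut⇒aboveAxis (s ∷ x) y (proj₂ ends′) c) , StartsWithSlope-prefix st
    where
    ends′ : Ends n ℤ.-1ℤ (y ++ s ∷ x)
    ends′ = Ends-rotate (s ∷ x) y ends

  rotate-unrotate : ∀ {n} q (ends : Ends n ℤ.-1ℤ q) st c → rotate (unrotate q ends st c) ≡ (q , ends , st)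
  rotate-unrotate _ (_ , y≡-1) _ (([] , y) , refl , c) = ⊥-elim (minimumCut-[] y y≡-1 c)
  rotate-unrotate _ ends st ((s ∷ x , y) , refl , c) = Σ-≡-irrelevant Ends×StartsWithSlope-irrelevant refl

  unrotate-rotate : ∀ {n} y x (ends : Ends n ℤ.-1ℤ (y ++ x)) (above : AboveAxis (y ++ x))
                    (st : StartsWithSlope x) (c : MinimumCutOf (+ 0) (x ++ y)) →
    unrotate (x ++ y) (Ends-rotate y x ends) (StartsWithSlope-++ st) c ≡ ((y , x) , (ends , above) , st)
  unrotate-rotate y (s ∷ x) ends above slope-first ((x′ , y′) , eq , c)
    with minimumCut-unique (+ 0) eq c (aboveAxis⇒minimumCut s x y (proj₂ ends) above)
  ... | refl with List.++-cancelˡ (s ∷ x) y′ y eq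
  ...   | refl with eq
  ...     | refl = Σ-≡-irrelevant MarkedSplit-irrelevant refl

  rotation : ∀ n → MarkedSplit n ↔ SlopeFirst n
  rotation n = mk↔ₛ′ rotate
    (λ (q , ends , st) → unrotate q ends st (minimumCut (+ 0) q))
    (λ (q , ends , st) → rotate-unrotate q ends st (minimumCut (+ 0) q))
    (λ ((y , x) , (ends , above) , st) → unrotate-rotate y x ends above st (minimumCut (+ 0) (x ++ y)))

  slopeFirst↔code : ∀ {n} → Σ (Walk (suc n)) (StartsWithSlope ∘ proj₁) ↔ Vec ℕ (suc (suc (n * 2)))
  slopeFirst↔code {n} = mk↔ₛ′ encode decode′ encode-decode decode-encode
    where
    encode : Σ (Walk (suc n)) (StartsWithSlope ∘ proj₁) → Vec ℕ (suc (suc (n * 2)))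
    encode ((S k _ ∷ p , e) , slope-first) = depth k ∷ codeWalk (p , ℕP.suc-injective e)
    decode′ : Vec ℕ (suc (suc (n * 2))) → Σ (Walk (suc n)) (StartsWithSlope ∘ proj₁)
    decode′ (j ∷ v) = slope j ∷ʷ decodeVec v , slope-first
    encode-decode : ∀ v → encode (decode′ v) ≡ v
    encode-decode (j ∷ v) = ≡.cong₂ _∷_ (stepWeight-slope j)
      (trans (cong (λ e → codeWalk (proj₁ w , e)) (uip (ℕP.suc-injective (proj₂ (slope j ∷ʷ w))) (proj₂ w)))
             (strictlyInverseˡ walk↔code v))
      where
      w : Walk n
      w = decodeVec v
    decode-encode : ∀ a → decode′ (encode a) ≡ a
    decode-encode ((S k k≤N ∷ p , e) , slope-first) =
      Σ-≡-irrelevant (λ _ → StartsWithSlope-irrelevant) (Σ-≡-irrelevant (λ _ → uip)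
        (≡.cong₂ _∷_ (slope-depth k k≤N)
                     (cong proj₁ (strictlyInverseʳ walk↔code (p , ℕP.suc-injective e)))))

  slopeFirst↔composition : ∀ n W →
    Σ (Path N) (λ q → (xEnd q ≡ suc n × weight q ≡ W) × StartsWithSlope q) ↔
    Composition (suc (suc (n * 2))) W
  slopeFirst↔composition n W =
    reassociate ⟫ Σ-fiber-↔ slopeFirst↔code (weight ∘ proj₁ ∘ proj₁) sum sum-encode W
    where
    reassociate : Σ (Path N) (λ q → (xEnd q ≡ suc n × weight q ≡ W) × StartsWithSlope q) ↔
                  Σ (Σ (Walk (suc n)) (StartsWithSlope ∘ proj₁)) (λ a → weight (proj₁ (proj₁ a)) ≡ W)
    reassociate = mk↔ₛ′ (λ (q , (e , w) , st) → ((q , e) , st) , w)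
                        (λ (((q , e) , st) , w) → q , (e , w) , st) (λ _ → refl) (λ _ → refl)
    sum-encode : ∀ a → sum (to slopeFirst↔code a) ≡ weight (proj₁ (proj₁ a))
    sum-encode ((S k _ ∷ p , e) , slope-first) =
      cong (λ w → depth k + w) (sum-codeWalk (p , ℕP.suc-injective e))

  cycle-lemma : ∀ n c → Fin c ↔ P N 1 (suc n) →
                Fin (suc n * c) ↔ Fin ((N * suc n + 1 + suc (n * 2)) C suc (n * 2))
  cycle-lemma n c Fin-c↔P =
    *↔× ⟫ ×-comm _ _ ⟫ Σ-↔ Fin-c↔P marks ⟫ Σ-slopeMark↔split ⟫ rotation (suc n)
    ⟫ Σ-↔ ↔-refl (λ {q} → Ends↔weight 1 (suc n) q ×-↔ ↔-refl)
    ⟫ slopeFirst↔composition n _ ⟫ composition↔binomial (suc (n * 2)) (N * suc n + 1)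
    where
    marks : ∀ {i} → Fin (suc n) ↔ SlopeMark (proj₁ (to Fin-c↔P i))
    marks {i} = ↔-sym (slopeMark↔Fin-xEnd _ ⟫ Fin-cong (proj₁ (proj₁ (proj₂ (to Fin-c↔P i)))))

  P-finite : ∀ n → Σ ℕ λ c → Fin c ↔ P N 1 n
  P-finite n = proj₁ finite , (proj₂ finite ⟫ Σ-assoc)
    where
    finite : Σ ℕ λ c → Fin c ↔ Σ (F N 1 n) (AboveAxis ∘ proj₁)
    finite = subset-finite (↔-sym (F↔binomial 1 n)) (AboveAxis ∘ proj₁) (AboveAxis? ∘ proj₁)
                           (λ _ → All.irrelevant ℤP.≤-irrelevant)

  F-count : ∀ m n → Fin (((N + 2) * n + m) C (2 * n)) ↔ F N m n
  F-count m n = Fin-cong (≡.cong₂ _C_ (top N n m) (ℕP.*-comm 2 n)) ⟫ ↔-sym (F↔binomial m n)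
    where
    top : ∀ N n m → (N + 2) * n + m ≡ N * n + m + n * 2
    top = ℕ-Solver.solve-∀

  P-count : ∀ n → Σ ℕ λ c → (Fin c ↔ P N 1 (suc n)) × (suc n * c ≡ ((N + 2) * suc n) C (2 * suc n ∸ 1))
  P-count n = c , Fin-c↔P ,
    trans (↔⇒≡ (cycle-lemma n c Fin-c↔P)) (≡.cong₂ _C_ (top N n) (cong (_∸ 1) (bottom n)))
    where
    c : ℕ
    c = proj₁ (P-finite (suc n))
    Fin-c↔P : Fin c ↔ P N 1 (suc n)
    Fin-c↔P = proj₂ (P-finite (suc n))
    top : ∀ N n → N * suc n + 1 + suc (n * 2) ≡ (N + 2) * suc n
    top = ℕ-Solver.solve-∀
    bottom : ∀ n → suc (suc (n * 2)) ≡ 2 * suc n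
    bottom = ℕ-Solver.solve-∀

mainTheorem19 : (N : ℕ) →
    ((m n : ℕ) → 1 ≤ n → Fin (((N + 2) * n + m) C (2 * n)) ↔ F N m n)
    × ((n : ℕ) → 1 ≤ n →
        Σ ℕ λ c → (Fin c ↔ P N 1 n) × (n * c ≡ ((N + 2) * n) C (2 * n ∸ 1)))
mainTheorem19 N = (λ m n _ → F-count m n) , λ { zero () ; (suc n) _ → P-count {N} n }
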